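{- Let $\sigma=\sigma_1\sigma_2\cdots\sigma_k$ be a Cayley permutation with $k\ge 2$, and let $\hat{\sigma}=\sigma_2\sigma_1\sigma_3\sigma_4\cdots\sigma_k$. If $\hat{\sigma}$ contains the pattern $231$, then $\mathrm{Sort}(\sigma)=\mathcal{C}(132,\sigma^r)$. In this case $\mathrm{Sort}(\sigma)$ is a class, whose basis is $\{132,\sigma^r\}$ if $\sigma^r$ avoids $132$, and $\{132\}$ otherwise.
   Context: A Cayley permutation is a finite word $\pi=\pi_1\cdots\pi_n$ over the positive integers such that every integer from $1$ to $\max(\pi)$ occurs at least once; $\mathcal{C}$ denotes the set of all Cayley permutations. A word $x=x_1\cdots x_n$ contains a pattern $p=p_1\cdots p_k\in\mathcal{C}$ if there are indices $i_1<\cdots<i_k$ such that for all $u,v$: $x_{i_u}<x_{i_v}$ iff $p_u<p_v$, and $x_{i_u}=x_{i_v}$ iff $p_u=p_v$; otherwise $x$ avoids $p$. For a set $B$ of patterns, $\mathcal{C}(B)$ (written $\mathcal{C}(p_1,\dots,p_m)$) is the set of Cayley permutations avoiding every pattern in $B$. A class is a subset of $\mathcal{C}$ closed downwards under pattern containment; its basis is the set of minimal (under containment) Cayley permutations not in the class. The reverse of $\pi=\pi_1\cdots\pi_n$ is $\pi^r=\pi_n\cdots\pi_1$. For a Cayley permutation $\tau$ of length at least two, a $\tau$-stack processes an input word from left to right with the following right-greedy algorithm: while the input is nonempty, if pushing the next input element onto the stack yields stack contents which, read from top to bottom, avoid $\tau$, the element is pushed; otherwise the top element of the stack is popped and appended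 to the output. When the input is exhausted, the remaining elements are popped one by one. Denote by $s_\tau(\pi)$ the output of the $\tau$-stack on input $\pi$. The $\sigma$-machine consists of a $\sigma$-stack followed in series by a $21$-stack: the output $s_\sigma(\pi)$ is used as input of a $21$-stack, operated by the same right-greedy algorithm with $\tau=21$ (so a letter may sit on a copy of itself). A Cayley permutation $\pi$ is $\sigma$-sortable if the final output of the $\sigma$-machine on input $\pi$ is weakly increasing; $\mathrm{Sort}(\sigma)$ denotes the set of $\sigma$-sortable Cayley permutations. -}

module Defs where

open import Data.Nat using (ℕ; zero; suc; _≤_; _<_; _⊔_; _≟_; _<?_)
open import Data.List using (List; []; _∷_; _++_; map; foldr; length; reverse)
open import Data.List.Relation.Unary.All using (All)
open import Data.List.Relation.Unary.Any using (Any; any?)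
open import Data.List.Relation.Unary.Linked using (Linked)
open import Data.List.Relation.Binary.Pointwise using (Pointwise)
import Data.List.Relation.Binary.Pointwise.Properties as PW
open import Data.List.Membership.Propositional using (_∈_)
open import Data.Product using (_×_; _,_; proj₁; proj₂)
open import Data.Bool using (Bool; true; false; if_then_else_)
open import Relation.Nullary using (¬_; Dec; yes; no; does)
open import Relation.Nullary.Decidable using (_×-dec_; _→-dec_; ¬?)
open import Relation.Binary.PropositionalEquality using (_≡_; _≢_)

_⟺_ : Set → Set → Set
A ⟺ B = (A → B) × (B → A)

maxW : List ℕ → ℕ
maxW = foldr _⊔_ 0

Cayley : List ℕ → Set
Cayley π = All (1 ≤_) π × (∀ i → 1 ≤ i → i ≤ maxW π → i ∈ π)

subseqs : List ℕ → List (List ℕ)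
subseqs []       = [] ∷ []
subseqs (x ∷ xs) = map (x ∷_) (subseqs xs) ++ subseqs xs

SameCmp : ℕ → ℕ → ℕ → ℕ → Set
SameCmp x y p q = ((x < y) ⟺ (p < q)) × ((y < x) ⟺ (q < p)) × ((x ≡ y) ⟺ (p ≡ q))

-- Order isomorphism of two words of equal length:
-- for all u < v, x_u ? x_v compares as p_u ? p_v.
data OrdIso : List ℕ → List ℕ → Set where
  []  : OrdIso [] []
  _∷_ : ∀ {x xs p ps} →
        Pointwise (λ y q → SameCmp x y p q) xs ps →
        OrdIso xs ps → OrdIso (x ∷ xs) (p ∷ ps)

Contains : List ℕ → List ℕ → Set
Contains x p = Any (λ s → OrdIso s p) (subseqs x)

Avoids : List ℕ → List ℕ → Set
Avoids x p = ¬ Contains x p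

private
  iff? : ∀ {A B : Set} → Dec A → Dec B → Dec (A ⟺ B)
  iff? a b = (a →-dec b) ×-dec (b →-dec a)

  sameCmp? : ∀ x y p q → Dec (SameCmp x y p q)
  sameCmp? x y p q =
    iff? (x <? y) (p <? q) ×-dec iff? (y <? x) (q <? p) ×-dec iff? (x ≟ y) (p ≟ q)

ordIso? : ∀ s p → Dec (OrdIso s p)
ordIso? [] [] = yes []
ordIso? [] (_ ∷ _) = no λ ()
ordIso? (_ ∷ _) [] = no λ ()
ordIso? (x ∷ xs) (p ∷ ps) with PW.decidable (λ y q → sameCmp? x y p q) xs ps | ordIso? xs ps
... | yes a | yes b = yes (a ∷ b)
... | no na | _     = no λ { (a ∷ _) → na a }
... | yes _ | no nb = no λ { (_ ∷ b) → nb b }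

contains? : ∀ x p → Dec (Contains x p)
contains? x p = any? (λ s → ordIso? s p) (subseqs x)

-- τ-stack.  Stacks are lists with the top element first, so the
-- stack contents "read from top to bottom" is the list itself.

-- Returns the new stack
-- and the emitted output.  (On an empty stack x is pushed
-- unconditionally; for |τ| ≥ 2 the one-letter stack avoids τ anyway.)
pushτ : List ℕ → List ℕ → ℕ → List ℕ × List ℕ
pushτ τ []       x = x ∷ [] , []
pushτ τ (t ∷ st) x with does (contains? (x ∷ t ∷ st) τ)
... | false = x ∷ t ∷ st , []
... | true  = let r = pushτ τ st x in proj₁ r , t ∷ proj₂ r

runτ : List ℕ → List ℕ → List ℕ → List ℕ
runτ τ st []       = st
runτ τ st (x ∷ xs) = let r = pushτ τ st x in proj₂ r ++ runτ τ (proj₁ r) xs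

stackOut : List ℕ → List ℕ → List ℕ
stackOut τ π = runτ τ [] π

machine : List ℕ → List ℕ → List ℕ
machine σ π = stackOut (2 ∷ 1 ∷ []) (stackOut σ π)

Sortable : List ℕ → List ℕ → Set
Sortable σ π = Linked _≤_ (machine σ π)

Sort : List ℕ → List ℕ → Set
Sort σ π = Cayley π × Sortable σ π

hat : List ℕ → List ℕ
hat (a ∷ b ∷ r) = b ∷ a ∷ r
hat σ           = σ

IsClass : (List ℕ → Set) → Set
IsClass C = (∀ π → C π → Cayley π) ×
            (∀ π τ → C π → Cayley τ → Contains π τ → C τ)

IsBasis : (List ℕ → Set) → List (List ℕ) → Set
IsBasis C B = ∀ β → (β ∈ B) ⟺
  (Cayley β × ¬ C β × (∀ τ → Cayley τ → Contains β τ → τ ≢ β → C τ))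

-- While its input avoids σʳ the σ-stack never pops, so it outputs the reverse of its input.
-- The first time a push would create an occurrence of σ on the stack, that occurrence uses the
-- incoming letter and the top of the stack as σ₁σ₂; the top is popped before the incoming letter,
-- so the output contains σ̂ and hence 231.  Since the 21-stack sorts exactly the 231-avoiding words
-- (Knuth), π is σ-sortable iff π avoids σʳ and reverse π avoids 231, i.e. π avoids 132.
-- The basis of such an avoidance class is the antichain of its minimal patterns, because
-- order-isomorphic Cayley permutations are equal; σʳ is redundant exactly when it contains 132.

module Submission where

open import Defs
open import Data.Nat using (ℕ; zero; suc; _≤_; _<_; z≤n; s≤s)
import Data.Nat.Properties as ℕ
open import Data.List using (List; []; _∷_; _++_; _ʳ++_; length; reverse; map; [_]; zip)
import Data.List.Properties as List
open import Data.List.Relation.Unary.All as All using (All; []; _∷_)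
open import Data.List.Relation.Unary.All.Properties using (¬All⇒Any¬)
open import Data.List.Relation.Unary.Any using (here; there)
import Data.List.Relation.Unary.Any.Properties as Any
open import Data.List.Relation.Unary.Linked using (Linked)
open import Data.List.Relation.Unary.AllPairs using (AllPairs; []; _∷_)
import Data.List.Relation.Unary.AllPairs.Properties as AllPairs
open import Data.List.Relation.Unary.Linked.Properties using (Linked⇒AllPairs; AllPairs⇒Linked)
open import Data.List.Relation.Binary.Pointwise as Pointwise using (Pointwise; []; _∷_)
open import Data.List.Relation.Binary.Equality.Propositional using (≋⇒≡)
open import Data.List.Relation.Binary.Sublist.Propositional
  using (_⊆_; []; _∷_; _∷ʳ_; ⊆-refl; ⊆-trans; minimum; from∈; to∈)
open import Data.List.Relation.Binary.Sublist.Propositional.Properties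
  using (++⁺; ++⁺ˡ; ++⁺ʳ; ∷⁻; reverse⁺; ʳ++⁺; length-mono-≤; to-≋; All-resp-⊆)
open import Data.List.Membership.Propositional using (_∈_; find; lose)
open import Data.List.Membership.Propositional.Properties
  using (∈-++⁺ˡ; ∈-++⁺ʳ; ∈-++⁻; ∈-map⁺; ∈-map⁻)
open import Data.Product using (∃; _×_; _,_; proj₁; proj₂)
open import Data.Sum using (_⊎_; inj₁; inj₂)
open import Data.Empty using (⊥; ⊥-elim)
open import Function using (_∘_)
open import Relation.Nullary using (¬_; yes; no; ¬?)
open import Relation.Nullary.Decidable using (decidable-stable)
open import Relation.Binary.PropositionalEquality
  using (_≡_; _≢_; refl; sym; cong; cong₂; subst; subst₂)

module _ {x y p q : ℕ} where

  SameCmp-sym : SameCmp x y p q → SameCmp y x q p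
  SameCmp-sym (<⇔ , >⇔ , (≡⇒ , ⇐≡)) = >⇔ , <⇔ , (λ e → sym (≡⇒ (sym e))) , (λ e → sym (⇐≡ (sym e)))

  SameCmp-swap : SameCmp x y p q → SameCmp p q x y
  SameCmp-swap ((a , b) , (c , d) , (e , f)) = (b , a) , (d , c) , (f , e)

  <⇒SameCmp : x < y → p < q → SameCmp x y p q
  <⇒SameCmp x<y p<q =
    ((λ _ → p<q) , (λ _ → x<y)) ,
    ((λ y<x → ⊥-elim (ℕ.<-asym x<y y<x)) , (λ q<p → ⊥-elim (ℕ.<-asym p<q q<p))) ,
    ((λ x≡y → ⊥-elim (ℕ.<-irrefl x≡y x<y)) , (λ p≡q → ⊥-elim (ℕ.<-irrefl p≡q p<q)))

  SameCmp-<⁺ : SameCmp x y p q → x < y → p < q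
  SameCmp-<⁺ ((x<y⇒p<q , _) , _) = x<y⇒p<q

  SameCmp-<⁻ : SameCmp x y p q → p < q → x < y
  SameCmp-<⁻ ((_ , p<q⇒x<y) , _) = p<q⇒x<y

>⇒SameCmp : ∀ {x y p q} → y < x → q < p → SameCmp x y p q
>⇒SameCmp y<x q<p = SameCmp-sym (<⇒SameCmp y<x q<p)

SameCmp-refl : ∀ {x y} → SameCmp x y x y
SameCmp-refl = ((λ h → h) , (λ h → h)) , ((λ h → h) , (λ h → h)) , ((λ h → h) , (λ h → h))

SameCmp-diag : ∀ {x p} → SameCmp x x p p
SameCmp-diag =
  ((λ x<x → ⊥-elim (ℕ.<-irrefl refl x<x)) , (λ p<p → ⊥-elim (ℕ.<-irrefl refl p<p))) ,
  ((λ x<x → ⊥-elim (ℕ.<-irrefl refl x<x)) , (λ p<p → ⊥-elim (ℕ.<-irrefl refl p<p))) ,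
  ((λ _ → refl) , (λ _ → refl))

SameCmp-trans : ∀ {x y p q u v} → SameCmp x y p q → SameCmp p q u v → SameCmp x y u v
SameCmp-trans ((a , b) , (c , d) , (e , f)) ((a′ , b′) , (c′ , d′) , (e′ , f′)) =
  ((λ h → a′ (a h)) , (λ h → b (b′ h))) ,
  ((λ h → c′ (c h)) , (λ h → d (d′ h))) ,
  ((λ h → e′ (e h)) , (λ h → f (f′ h)))

OrdIso-refl : ∀ w → OrdIso w w
OrdIso-refl []      = []
OrdIso-refl (_ ∷ w) = Pointwise.refl SameCmp-refl ∷ OrdIso-refl w

OrdIso-sym : ∀ {s p} → OrdIso s p → OrdIso p s
OrdIso-sym []       = []
OrdIso-sym (r ∷ o) = Pointwise.symmetric SameCmp-swap r ∷ OrdIso-sym o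

OrdIso-trans : ∀ {a b c} → OrdIso a b → OrdIso b c → OrdIso a c
OrdIso-trans []       []        = []
OrdIso-trans (r ∷ o) (r′ ∷ o′) = Pointwise.transitive SameCmp-trans r r′ ∷ OrdIso-trans o o′

OrdIso-swap : ∀ {x y s p q r} → OrdIso (x ∷ y ∷ s) (p ∷ q ∷ r) → OrdIso (y ∷ x ∷ s) (q ∷ p ∷ r)
OrdIso-swap ((xy ∷ xs) ∷ (ys ∷ o)) = (SameCmp-sym xy ∷ ys) ∷ (xs ∷ o)

OrdIso-length : ∀ {s p} → OrdIso s p → length s ≡ length p
OrdIso-length []      = refl
OrdIso-length (_ ∷ o) = cong suc (OrdIso-length o)

OrdIso-∷ʳ : ∀ {a b x p} → OrdIso a b → Pointwise (λ y q → SameCmp y x q p) a b →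
            OrdIso (a ++ [ x ]) (b ++ [ p ])
OrdIso-∷ʳ []       []       = [] ∷ []
OrdIso-∷ʳ (r ∷ o) (h ∷ hs) = Pointwise.++⁺ r (h ∷ []) ∷ OrdIso-∷ʳ o hs

OrdIso-reverse : ∀ {s p} → OrdIso s p → OrdIso (reverse s) (reverse p)
OrdIso-reverse []       = []
OrdIso-reverse {x ∷ xs} {p ∷ ps} (r ∷ o) =
  subst₂ OrdIso (sym (List.unfold-reverse x xs)) (sym (List.unfold-reverse p ps))
    (OrdIso-∷ʳ (OrdIso-reverse o) (Pointwise.reverse⁺ (Pointwise.map SameCmp-sym r)))

∈-subseqs⁺ : ∀ {s w} → s ⊆ w → s ∈ subseqs w
∈-subseqs⁺ []                    = here refl
∈-subseqs⁺ {w = y ∷ w} (y ∷ʳ ρ)  = ∈-++⁺ʳ (map (y ∷_) (subseqs w)) (∈-subseqs⁺ ρ)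
∈-subseqs⁺ {w = y ∷ w} (refl ∷ ρ) = ∈-++⁺ˡ (∈-map⁺ (y ∷_) (∈-subseqs⁺ ρ))

∈-subseqs⁻ : ∀ {s} w → s ∈ subseqs w → s ⊆ w
∈-subseqs⁻ []      (here refl) = []
∈-subseqs⁻ (y ∷ w) s∈ with ∈-++⁻ (map (y ∷_) (subseqs w)) s∈
... | inj₂ s∈′ = y ∷ʳ ∈-subseqs⁻ w s∈′
... | inj₁ s∈′ with ∈-map⁻ (y ∷_) s∈′
...   | _ , t∈ , refl = refl ∷ ∈-subseqs⁻ w t∈

record Occurrence (w p : List ℕ) : Set where
  constructor occurrence
  field
    {image} : List ℕ
    image⊆  : image ⊆ w
    image≅  : OrdIso image p

Contains⇒Occurrence : ∀ w {p} → Contains w p → Occurrence w p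
Contains⇒Occurrence w c with find c
... | _ , s∈ , s≅ = occurrence (∈-subseqs⁻ w s∈) s≅

Occurrence⇒Contains : ∀ {w p} → Occurrence w p → Contains w p
Occurrence⇒Contains (occurrence s⊆ s≅) = lose (∈-subseqs⁺ s⊆) s≅

Occurrence-refl : ∀ w → Occurrence w w
Occurrence-refl w = occurrence ⊆-refl (OrdIso-refl w)

Occurrence-mono : ∀ {w w′ p} → w ⊆ w′ → Occurrence w p → Occurrence w′ p
Occurrence-mono w⊆ (occurrence s⊆ s≅) = occurrence (⊆-trans s⊆ w⊆) s≅

Occurrence-length : ∀ {w p} → Occurrence w p → length p ≤ length w
Occurrence-length (occurrence s⊆ s≅) = subst (_≤ _) (OrdIso-length s≅) (length-mono-≤ s⊆)

Occurrence-reverse : ∀ {w p} → Occurrence w p → Occurrence (reverse w) (reverse p)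
Occurrence-reverse (occurrence s⊆ s≅) = occurrence (reverse⁺ s⊆) (OrdIso-reverse s≅)

Occurrence-reverseˡ : ∀ w {p} → Occurrence (reverse w) p → Occurrence w (reverse p)
Occurrence-reverseˡ w occ = subst (λ v → Occurrence v _) (List.reverse-involutive w) (Occurrence-reverse occ)

Occurrence-reverseʳ : ∀ {w p} → Occurrence w (reverse p) → Occurrence (reverse w) p
Occurrence-reverseʳ {p = p} occ = subst (Occurrence _) (List.reverse-involutive p) (Occurrence-reverse occ)

-- For ρ : u ⊆ b and s as long as b, select ρ s is the subword of s at the positions ρ picks out of b.
select : ∀ {u b : List ℕ} → u ⊆ b → List ℕ → List ℕ
select []       _       = []
select (_ ∷ʳ ρ) []      = []
select (_ ∷ʳ ρ) (_ ∷ s) = select ρ s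
select (_ ∷ ρ)  []      = []
select (_ ∷ ρ)  (x ∷ s) = x ∷ select ρ s

select-⊆ : ∀ {u b : List ℕ} (ρ : u ⊆ b) s → select ρ s ⊆ s
select-⊆ []       s       = minimum s
select-⊆ (_ ∷ʳ ρ) []      = []
select-⊆ (_ ∷ʳ ρ) (x ∷ s) = x ∷ʳ select-⊆ ρ s
select-⊆ (_ ∷ ρ)  []      = []
select-⊆ (_ ∷ ρ)  (x ∷ s) = refl ∷ select-⊆ ρ s

select-Pointwise : ∀ {R : ℕ → ℕ → Set} {u b s : List ℕ} →
                   Pointwise R s b → (ρ : u ⊆ b) → Pointwise R (select ρ s) u
select-Pointwise []       []          = []
select-Pointwise (_ ∷ rs) (_ ∷ʳ ρ)    = select-Pointwise rs ρ
select-Pointwise (r ∷ rs) (refl ∷ ρ)  = r ∷ select-Pointwise rs ρ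

select-OrdIso : ∀ {u b s : List ℕ} → OrdIso s b → (ρ : u ⊆ b) → OrdIso (select ρ s) u
select-OrdIso []       []         = []
select-OrdIso (_ ∷ o)  (_ ∷ʳ ρ)   = select-OrdIso o ρ
select-OrdIso (r ∷ o)  (refl ∷ ρ) = select-Pointwise r ρ ∷ select-OrdIso o ρ

Occurrence-trans : ∀ {a b c} → Occurrence a b → Occurrence b c → Occurrence a c
Occurrence-trans (occurrence {s} s⊆ s≅) (occurrence u⊆ u≅) =
  occurrence (⊆-trans (select-⊆ u⊆ s) s⊆) (OrdIso-trans (select-OrdIso s≅ u⊆) u≅)

Occurrence-long⇒OrdIso : ∀ {w p} → Occurrence w p → length w ≤ length p → OrdIso w p
Occurrence-long⇒OrdIso (occurrence s⊆ s≅) w≤p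
  with ≋⇒≡ (to-≋ (ℕ.≤-antisym (length-mono-≤ s⊆) (subst (_ ≤_) (sym (OrdIso-length s≅)) w≤p)) s⊆)
... | refl = s≅

p21 p231 p132 : List ℕ
p21  = 2 ∷ 1 ∷ []
p231 = 2 ∷ 3 ∷ 1 ∷ []
p132 = 1 ∷ 3 ∷ 2 ∷ []

Descent : List ℕ → Set
Descent w = ∃ λ b → ∃ λ a → a < b × b ∷ a ∷ [] ⊆ w

Descent⇒Occurrence21 : ∀ {w} → Descent w → Occurrence w p21
Descent⇒Occurrence21 (_ , _ , a<b , ba⊆) = occurrence ba⊆ ((>⇒SameCmp a<b ℕ.≤-refl ∷ []) ∷ ([] ∷ []))

Occurrence21⇒Descent : ∀ {w} → Occurrence w p21 → Descent w
Occurrence21⇒Descent (occurrence ba⊆ ((r ∷ []) ∷ ([] ∷ []))) = _ , _ , SameCmp-<⁻ (SameCmp-sym r) ℕ.≤-refl , ba⊆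

Occurrence231 : ∀ {w a b c} → a < b → b < c → b ∷ c ∷ a ∷ [] ⊆ w → Occurrence w p231
Occurrence231 a<b b<c bca⊆ = occurrence bca⊆
  ((<⇒SameCmp b<c ℕ.≤-refl ∷ >⇒SameCmp a<b ℕ.≤-refl ∷ []) ∷
   ((>⇒SameCmp (ℕ.<-trans a<b b<c) (s≤s (s≤s z≤n)) ∷ []) ∷
    ([] ∷ [])))

Occurrence231⁻ : ∀ {w} → Occurrence w p231 →
                 ∃ λ b → ∃ λ c → ∃ λ a → a < b × b < c × b ∷ c ∷ a ∷ [] ⊆ w
Occurrence231⁻ (occurrence bca⊆ ((bc ∷ ba ∷ []) ∷ _)) =
  _ , _ , _ , SameCmp-<⁻ (SameCmp-sym ba) ℕ.≤-refl , SameCmp-<⁻ bc ℕ.≤-refl , bca⊆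

∈⇒≤maxW : ∀ {x w} → x ∈ w → x ≤ maxW w
∈⇒≤maxW {w = y ∷ w} (here refl) = ℕ.m≤m⊔n y (maxW w)
∈⇒≤maxW {w = y ∷ w} (there x∈) = ℕ.≤-trans (∈⇒≤maxW x∈) (ℕ.m≤n⊔m y (maxW w))

maxW-lub : ∀ {m w} → All (_≤ m) w → maxW w ≤ m
maxW-lub []         = z≤n
maxW-lub (x≤ ∷ xs≤) = ℕ.⊔-lub x≤ (maxW-lub xs≤)

Cayley-reverse : ∀ w → Cayley w → Cayley (reverse w)
Cayley-reverse w (positive , surjective) =
  All.tabulate (λ x∈ → All.lookup positive (Any.reverse⁻ x∈)) ,
  λ i 1≤i i≤max → Any.reverse⁺ (surjective i 1≤i (ℕ.≤-trans i≤max maxW-reverse))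
  where
  maxW-reverse : maxW (reverse w) ≤ maxW w
  maxW-reverse = maxW-lub (All.tabulate (λ x∈ → ∈⇒≤maxW (Any.reverse⁻ {xs = w} x∈)))

Cayley132 : Cayley p132
Cayley132 = (s≤s z≤n ∷ s≤s z≤n ∷ s≤s z≤n ∷ []) , covered
  where
  covered : ∀ i → 1 ≤ i → i ≤ maxW p132 → i ∈ p132
  covered 1 _ _ = here refl
  covered 2 _ _ = there (there (here refl))
  covered 3 _ _ = there (here refl)
  covered (suc (suc (suc (suc _)))) _ (s≤s (s≤s (s≤s ())))

zip-∈ˡ : ∀ {a b : List ℕ} {x p} → (x , p) ∈ zip a b → x ∈ a
zip-∈ˡ {_ ∷ _} {_ ∷ _} (here refl) = here refl
zip-∈ˡ {_ ∷ _} {_ ∷ _} (there xp∈) = there (zip-∈ˡ xp∈)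

zip-∈ʳ : ∀ {a b : List ℕ} {x p} → (x , p) ∈ zip a b → p ∈ b
zip-∈ʳ {_ ∷ _} {_ ∷ _} (here refl) = here refl
zip-∈ʳ {_ ∷ _} {_ ∷ _} (there xp∈) = there (zip-∈ʳ xp∈)

zip-swap : ∀ {a b : List ℕ} {x p} → (x , p) ∈ zip a b → (p , x) ∈ zip b a
zip-swap {_ ∷ _} {_ ∷ _} (here refl) = here refl
zip-swap {_ ∷ _} {_ ∷ _} (there xp∈) = there (zip-swap xp∈)

Pointwise-zip : ∀ {R : ℕ → ℕ → Set} {xs ys y q} → Pointwise R xs ys → (y , q) ∈ zip xs ys → R y q
Pointwise-zip (r ∷ _)  (here refl) = r
Pointwise-zip (_ ∷ rs) (there yq∈) = Pointwise-zip rs yq∈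

OrdIso-partner : ∀ {a b x} → OrdIso a b → x ∈ a → ∃ λ p → (x , p) ∈ zip a b
OrdIso-partner {b = p ∷ _} (_ ∷ _) (here refl) = p , here refl
OrdIso-partner (_ ∷ o) (there x∈) with OrdIso-partner o x∈
... | p , xp∈ = p , there xp∈

OrdIso-zip : ∀ {a b x p y q} → OrdIso a b → (x , p) ∈ zip a b → (y , q) ∈ zip a b → SameCmp x y p q
OrdIso-zip (_ ∷ _) (here refl) (here refl) = SameCmp-diag
OrdIso-zip (r ∷ _) (here refl) (there yq∈) = Pointwise-zip r yq∈
OrdIso-zip (r ∷ _) (there xp∈) (here refl) = SameCmp-sym (Pointwise-zip r xp∈)
OrdIso-zip (_ ∷ o) (there xp∈) (there yq∈) = OrdIso-zip o xp∈ yq∈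

-- Induction on the letter x: x - 1 occurs in a (Cayley) with a partner q ≥ x - 1, and order-isomorphism forces q < p.
Cayley-OrdIso-≤ : ∀ {a b} → Cayley a → Cayley b → OrdIso a b → ∀ x {p} → (x , p) ∈ zip a b → x ≤ p
Cayley-OrdIso-≤ ca cb o zero          xp∈ = z≤n
Cayley-OrdIso-≤ ca cb o (suc zero)    xp∈ = All.lookup (proj₁ cb) (zip-∈ʳ xp∈)
Cayley-OrdIso-≤ ca cb o (suc (suc k)) xp∈ =
  let q , kq∈ = OrdIso-partner o
                  (proj₂ ca (suc k) (s≤s z≤n) (ℕ.≤-trans (ℕ.n≤1+n _) (∈⇒≤maxW (zip-∈ˡ xp∈))))
  in ℕ.≤-trans (s≤s (Cayley-OrdIso-≤ ca cb o (suc k) kq∈)) (SameCmp-<⁺ (OrdIso-zip o kq∈ xp∈) ℕ.≤-refl)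

zip-≡⇒≡ : ∀ {a b} → OrdIso a b → (∀ {x p} → (x , p) ∈ zip a b → x ≡ p) → a ≡ b
zip-≡⇒≡ []      eq = refl
zip-≡⇒≡ (_ ∷ o) eq = cong₂ _∷_ (eq (here refl)) (zip-≡⇒≡ o (λ xp∈ → eq (there xp∈)))

Cayley-OrdIso⇒≡ : ∀ {a b} → Cayley a → Cayley b → OrdIso a b → a ≡ b
Cayley-OrdIso⇒≡ ca cb o = zip-≡⇒≡ o λ {x} xp∈ →
  ℕ.≤-antisym (Cayley-OrdIso-≤ ca cb o x xp∈) (Cayley-OrdIso-≤ cb ca (OrdIso-sym o) _ (zip-swap xp∈))

Cayley-Occurrence-long⇒≡ : ∀ {a b} → Cayley a → Cayley b → Occurrence a b → length a ≤ length b → a ≡ b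
Cayley-Occurrence-long⇒≡ ca cb a⊒b a≤b = Cayley-OrdIso⇒≡ ca cb (Occurrence-long⇒OrdIso a⊒b a≤b)

Contains-trans : ∀ a {b c} → Contains a b → Contains b c → Contains a c
Contains-trans a a⊒b b⊒c =
  Occurrence⇒Contains (Occurrence-trans (Contains⇒Occurrence a a⊒b) (Contains⇒Occurrence _ b⊒c))

Contains-refl : ∀ w → Contains w w
Contains-refl w = Occurrence⇒Contains (Occurrence-refl w)

module AvoidanceClass (C : List ℕ → Set) (B : List (List ℕ))
                      (C⇔ : ∀ π → C π ⟺ (Cayley π × All (Avoids π) B)) where

  isClass : IsClass C
  isClass = (λ π → proj₁ ∘ proj₁ (C⇔ π)) , closed
    where
    closed : ∀ π τ → C π → Cayley τ → Contains π τ → C τ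
    closed π τ π∈C τ-cayley π⊒τ = proj₂ (C⇔ τ)
      (τ-cayley , All.map (λ avoid τ⊒β → avoid (Contains-trans π π⊒τ τ⊒β)) (proj₂ (proj₁ (C⇔ π) π∈C)))

  basis-∉ : ∀ {β} → β ∈ B → ¬ C β
  basis-∉ β∈ β∈C = All.lookup (proj₂ (proj₁ (C⇔ _) β∈C)) β∈ (Contains-refl _)

  isBasis : All Cayley B → (∀ {β β′} → β ∈ B → β′ ∈ B → Contains β β′ → β′ ≡ β) → IsBasis C B
  isBasis B-cayley antichain β = basis⇒minimal , minimal⇒basis
    where
    basis⇒minimal : β ∈ B → Cayley β × ¬ C β × (∀ τ → Cayley τ → Contains β τ → τ ≢ β → C τ)
    basis⇒minimal β∈ = β-cayley , basis-∉ β∈ , minimal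
      where
      β-cayley : Cayley β
      β-cayley = All.lookup B-cayley β∈
      -- If τ contained some β′ ∈ B then so would β, forcing β′ = β and hence τ = β.
      minimal : ∀ τ → Cayley τ → Contains β τ → τ ≢ β → C τ
      minimal τ τ-cayley β⊒τ τ≢β = proj₂ (C⇔ τ) (τ-cayley , All.tabulate avoids)
        where
        avoids : ∀ {β′} → β′ ∈ B → Avoids τ β′
        avoids β′∈ τ⊒β′ with antichain β∈ β′∈ (Contains-trans β β⊒τ τ⊒β′)
        ... | refl = τ≢β (Cayley-Occurrence-long⇒≡ τ-cayley β-cayley
                           (Contains⇒Occurrence τ τ⊒β′) (Occurrence-length (Contains⇒Occurrence β β⊒τ)))

    minimal⇒basis : Cayley β × ¬ C β × (∀ τ → Cayley τ → Contains β τ → τ ≢ β → C τ) → β ∈ B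
    minimal⇒basis (β-cayley , β∉C , minimal)
      with find (¬All⇒Any¬ (λ p → ¬? (contains? β p)) B λ avoids → β∉C (proj₂ (C⇔ β) (β-cayley , avoids)))
    ... | β′ , β′∈ , ¬avoids with List.≡-dec ℕ._≟_ β′ β
    ...   | yes refl = β′∈
    ...   | no β′≢β  = ⊥-elim (basis-∉ β′∈ (minimal β′ (All.lookup B-cayley β′∈)
                                  (decidable-stable (contains? β β′) ¬avoids) β′≢β))

data PushSplit (τ : List ℕ) (x : ℕ) : List ℕ → List ℕ × List ℕ → Set where
  split : ∀ popped kept → kept ≡ [] ⊎ ¬ Occurrence (x ∷ kept) τ →
          PushSplit τ x (popped ++ kept) (x ∷ kept , popped)

pushτ-split : ∀ τ st x → PushSplit τ x st (pushτ τ st x)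
pushτ-split τ []       x = split [] [] (inj₁ refl)
pushτ-split τ (t ∷ st) x with contains? (x ∷ t ∷ st) τ
... | no avoids = split [] (t ∷ st) (inj₂ λ occ → avoids (Occurrence⇒Contains occ))
... | yes _ with pushτ τ st x | pushτ-split τ st x
...   | _ | split popped kept kept-ok = split (t ∷ popped) kept kept-ok

stack⊆runτ : ∀ τ st xs → st ⊆ runτ τ st xs
stack⊆runτ τ st []       = ⊆-refl
stack⊆runτ τ st (x ∷ xs) = go (pushτ-split τ st x)
  where
  go : ∀ {st r} → PushSplit τ x st r → st ⊆ proj₂ r ++ runτ τ (proj₁ r) xs
  go (split popped kept _) = ++⁺ ⊆-refl (⊆-trans (x ∷ʳ ⊆-refl) (stack⊆runτ τ (x ∷ kept) xs))

∈-runτ⁻ : ∀ τ st xs {y} → y ∈ runτ τ st xs → y ∈ st ⊎ y ∈ xs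
∈-runτ⁻ τ st []       y∈ = inj₁ y∈
∈-runτ⁻ τ st (x ∷ xs) y∈ = go (pushτ-split τ st x) y∈
  where
  go : ∀ {st r y} → PushSplit τ x st r → y ∈ proj₂ r ++ runτ τ (proj₁ r) xs → y ∈ st ⊎ y ∈ x ∷ xs
  go (split popped kept _) y∈ with ∈-++⁻ popped y∈
  ... | inj₁ y∈popped = inj₁ (∈-++⁺ˡ y∈popped)
  ... | inj₂ y∈run with ∈-runτ⁻ τ (x ∷ kept) xs y∈run
  ...   | inj₁ (here y≡x)     = inj₂ (here y≡x)
  ...   | inj₁ (there y∈kept) = inj₁ (∈-++⁺ʳ popped y∈kept)
  ...   | inj₂ y∈xs           = inj₂ (there y∈xs)

AllPairs-resp-⊇ : ∀ {R : ℕ → ℕ → Set} {xs ys : List ℕ} → xs ⊆ ys → AllPairs R ys → AllPairs R xs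
AllPairs-resp-⊇ []         []       = []
AllPairs-resp-⊇ (_ ∷ʳ ρ)   (_ ∷ rs) = AllPairs-resp-⊇ ρ rs
AllPairs-resp-⊇ (refl ∷ ρ) (r ∷ rs) = All-resp-⊆ ρ r ∷ AllPairs-resp-⊇ ρ rs

sorted⇒¬Descent : ∀ {w} → AllPairs _≤_ w → ¬ Descent w
sorted⇒¬Descent sorted (_ , _ , a<b , ba⊆) with AllPairs-resp-⊇ ba⊆ sorted
... | (b≤a ∷ []) ∷ _ = ℕ.<⇒≱ a<b b≤a

data SortedPush (x : ℕ) : List ℕ → List ℕ × List ℕ → Set where
  sorted-split : ∀ {popped kept} → All (_< x) popped → All (x ≤_) kept →
                 SortedPush x (popped ++ kept) (x ∷ kept , popped)

push21-split : ∀ st x → AllPairs _≤_ st → SortedPush x st (pushτ p21 st x)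
push21-split []       x _ = sorted-split [] []
push21-split (t ∷ st) x (t≤st ∷ st-sorted) with contains? (x ∷ t ∷ st) p21
... | no avoids = sorted-split [] (x≤t ∷ All.map (ℕ.≤-trans x≤t) t≤st)
  where
  x≤t : x ≤ t
  x≤t = ℕ.≮⇒≥ λ t<x →
    avoids (Occurrence⇒Contains (Descent⇒Occurrence21 (_ , _ , t<x , refl ∷ refl ∷ minimum st)))
... | yes has21 with pushτ p21 st x | push21-split st x st-sorted
...   | _ | sorted-split popped<x x≤kept = sorted-split (t<x ∷ popped<x) x≤kept
  where
  t<x : t < x
  t<x with Occurrence21⇒Descent (Contains⇒Occurrence _ has21)
  ... | _ , _ , a<b , _ ∷ʳ ba⊆ = ⊥-elim (sorted⇒¬Descent (t≤st ∷ st-sorted) (_ , _ , a<b , ba⊆))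
  ... | _ , _ , a<b , refl ∷ a⊆ with to∈ a⊆
  ...   | here refl  = a<b
  ...   | there a∈st = ℕ.≤-<-trans (All.lookup t≤st a∈st) a<b

-- A 231 that the 21-stack has not yet resolved: its 2 is already on the stack, or all three letters are still unread.
Pending231 : List ℕ → List ℕ → Set
Pending231 st xs = ∃ λ b → ∃ λ c → ∃ λ a → a < b × b < c ×
  (b ∈ st × c ∷ a ∷ [] ⊆ xs ⊎ b ∷ c ∷ a ∷ [] ⊆ xs)

Inversion : List ℕ → List ℕ → Set
Inversion out xs = ∃ λ b → ∃ λ a → b ∈ out × a ∈ xs × a < b

kept-above-top : ∀ {x kept b} → kept ≡ [] ⊎ ¬ Occurrence (x ∷ kept) p21 → b ∈ kept → b < x → ⊥
kept-above-top (inj₁ refl)  ()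
kept-above-top (inj₂ avoid) b∈ b<x = avoid (Descent⇒Occurrence21 (_ , _ , b<x , refl ∷ from∈ b∈))

-- When the 3 of a pending 231 is pushed, its 2 is popped before the 1 is read, so the 2 precedes the 1 in the output.
run21-Descent : ∀ xs st out → Inversion out xs ⊎ Pending231 st xs → Descent (out ++ runτ p21 st xs)
run21-Descent [] st out (inj₁ (_ , _ , _ , () , _))
run21-Descent [] st out (inj₂ (_ , _ , _ , _ , _ , inj₁ (_ , ())))
run21-Descent [] st out (inj₂ (_ , _ , _ , _ , _ , inj₂ ()))
run21-Descent (x ∷ xs) st out = go (pushτ-split p21 st x)
  where
  go : ∀ {st r} → PushSplit p21 x st r → Inversion out (x ∷ xs) ⊎ Pending231 st (x ∷ xs) →
       Descent (out ++ proj₂ r ++ runτ p21 (proj₁ r) xs)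
  go (split popped kept kept-ok) = resolve
    where
    R : List ℕ
    R = runτ p21 (x ∷ kept) xs

    ih : Inversion (out ++ popped) xs ⊎ Pending231 (x ∷ kept) xs → Descent (out ++ popped ++ R)
    ih h = subst Descent (List.++-assoc out popped R) (run21-Descent xs (x ∷ kept) (out ++ popped) h)

    resolve : Inversion out (x ∷ xs) ⊎ Pending231 (popped ++ kept) (x ∷ xs) → Descent (out ++ popped ++ R)
    resolve (inj₁ (b , a , b∈out , here refl , a<b)) =
      b , a , a<b , ++⁺ (from∈ b∈out) (++⁺ˡ popped (from∈ (to∈ (stack⊆runτ p21 (x ∷ kept) xs))))
    resolve (inj₁ (b , a , b∈out , there a∈xs , a<b)) = ih (inj₁ (b , a , ∈-++⁺ˡ b∈out , a∈xs , a<b))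
    resolve (inj₂ (b , c , a , a<b , b<c , inj₁ (b∈st , ca⊆))) with ∈-++⁻ popped b∈st | ca⊆
    ... | inj₁ b∈popped | _ = ih (inj₁ (b , a , ∈-++⁺ʳ out b∈popped , to∈ (∷⁻ ca⊆) , a<b))
    ... | inj₂ b∈kept | _ ∷ʳ ca⊆′ = ih (inj₂ (b , c , a , a<b , b<c , inj₁ (there b∈kept , ca⊆′)))
    ... | inj₂ b∈kept | refl ∷ _ = ⊥-elim (kept-above-top kept-ok b∈kept b<c)
    resolve (inj₂ (b , c , a , a<b , b<c , inj₂ (_ ∷ʳ bca⊆))) = ih (inj₂ (b , c , a , a<b , b<c , inj₂ bca⊆))
    resolve (inj₂ (b , c , a , a<b , b<c , inj₂ (refl ∷ ca⊆))) =
      ih (inj₂ (b , c , a , a<b , b<c , inj₁ (here refl , ca⊆)))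

run21-sorted : ∀ xs st → AllPairs _≤_ st → ¬ Pending231 st xs → AllPairs _≤_ (runτ p21 st xs)
run21-sorted []       st sorted _ = sorted
run21-sorted (x ∷ xs) st sorted no231 = go (push21-split st x sorted) sorted no231
  where
  go : ∀ {st r} → SortedPush x st r → AllPairs _≤_ st → ¬ Pending231 st (x ∷ xs) →
       AllPairs _≤_ (proj₂ r ++ runτ p21 (proj₁ r) xs)
  go (sorted-split {popped} {kept} popped<x x≤kept) sorted no231 =
    AllPairs.++⁺ (AllPairs-resp-⊇ (++⁺ʳ kept ⊆-refl) sorted)
                 (run21-sorted xs (x ∷ kept) (x≤kept ∷ AllPairs-resp-⊇ (++⁺ˡ popped ⊆-refl) sorted) no231′)
                 (All.tabulate λ b∈ → All.tabulate λ y∈ → popped≤run b∈ (∈-runτ⁻ p21 (x ∷ kept) xs y∈))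
    where
    no231′ : ¬ Pending231 (x ∷ kept) xs
    no231′ (b , c , a , a<b , b<c , inj₁ (here refl , ca⊆)) = no231 (b , c , a , a<b , b<c , inj₂ (refl ∷ ca⊆))
    no231′ (b , c , a , a<b , b<c , inj₁ (there b∈ , ca⊆)) =
      no231 (b , c , a , a<b , b<c , inj₁ (∈-++⁺ʳ popped b∈ , x ∷ʳ ca⊆))
    no231′ (b , c , a , a<b , b<c , inj₂ bca⊆) = no231 (b , c , a , a<b , b<c , inj₂ (x ∷ʳ bca⊆))

    -- A later letter y < b would complete the 231 formed by b (on the stack) and x.
    popped≤run : ∀ {b y} → b ∈ popped → y ∈ x ∷ kept ⊎ y ∈ xs → b ≤ y
    popped≤run b∈ (inj₁ (here refl))  = ℕ.<⇒≤ (All.lookup popped<x b∈)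
    popped≤run b∈ (inj₁ (there y∈))   = ℕ.<⇒≤ (ℕ.<-≤-trans (All.lookup popped<x b∈) (All.lookup x≤kept y∈))
    popped≤run b∈ (inj₂ y∈) = ℕ.≮⇒≥ λ y<b →
      no231 (_ , _ , _ , y<b , All.lookup popped<x b∈ , inj₁ (∈-++⁺ˡ b∈ , refl ∷ from∈ y∈))

stack21-sorted⇔avoids231 : ∀ w → Linked _≤_ (stackOut p21 w) ⟺ Avoids w p231
stack21-sorted⇔avoids231 w = sorted⇒avoids , avoids⇒sorted
  where
  sorted⇒avoids : Linked _≤_ (stackOut p21 w) → Avoids w p231
  sorted⇒avoids linked has231 with Occurrence231⁻ (Contains⇒Occurrence w has231)
  ... | b , c , a , a<b , b<c , bca⊆ =
    sorted⇒¬Descent (Linked⇒AllPairs ℕ.≤-trans linked)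
      (run21-Descent w [] [] (inj₂ (b , c , a , a<b , b<c , inj₂ bca⊆)))

  avoids⇒sorted : Avoids w p231 → Linked _≤_ (stackOut p21 w)
  avoids⇒sorted avoids = AllPairs⇒Linked (run21-sorted w [] [] no231)
    where
    no231 : ¬ Pending231 [] w
    no231 (_ , _ , _ , _ , _ , inj₁ (() , _))
    no231 (_ , _ , _ , a<b , b<c , inj₂ bca⊆) = avoids (Occurrence⇒Contains (Occurrence231 a<b b<c bca⊆))

module σ-Stack (σ₁ σ₂ : ℕ) (σ′ : List ℕ) where

  σ : List ℕ
  σ = σ₁ ∷ σ₂ ∷ σ′

  singleton-avoids : ∀ x → ¬ Occurrence [ x ] σ
  singleton-avoids x occ with Occurrence-length occ
  ... | s≤s ()

  pushσ-no-pop : ∀ st x → ¬ Occurrence (x ∷ st) σ → pushτ σ st x ≡ (x ∷ st , [])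
  pushσ-no-pop []       x _     = refl
  pushσ-no-pop (t ∷ st) x avoid with contains? (x ∷ t ∷ st) σ
  ... | yes has = ⊥-elim (avoid (Contains⇒Occurrence _ has))
  ... | no _    = refl

  runσ-no-pop : ∀ xs st → ¬ Occurrence (xs ʳ++ st) σ → runτ σ st xs ≡ xs ʳ++ st
  runσ-no-pop []       st _     = refl
  runσ-no-pop (x ∷ xs) st avoid
    rewrite pushσ-no-pop st x (λ occ → avoid (Occurrence-mono (ʳ++⁺ (minimum xs) ⊆-refl) occ)) =
    runσ-no-pop xs (x ∷ st) avoid

  -- The occurrence must use both x and t, as σ₁ and σ₂; popping t first swaps them.
  hat-after-pop : ∀ t st x xs → ¬ Occurrence (t ∷ st) σ → ¬ Occurrence (x ∷ st) σ →
                  Occurrence (x ∷ t ∷ st) σ → Occurrence (t ∷ runτ σ (x ∷ st) xs) (hat σ)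
  hat-after-pop t st x xs t∷st-avoids _ (occurrence (_ ∷ʳ s⊆) s≅) = ⊥-elim (t∷st-avoids (occurrence s⊆ s≅))
  hat-after-pop t st x xs _ x∷st-avoids (occurrence (refl ∷ _ ∷ʳ s⊆) s≅) =
    ⊥-elim (x∷st-avoids (occurrence (refl ∷ s⊆) s≅))
  hat-after-pop t st x xs _ _ (occurrence (refl ∷ refl ∷ s⊆) s≅) =
    occurrence (refl ∷ ⊆-trans (refl ∷ s⊆) (stack⊆runτ σ (x ∷ st) xs)) (OrdIso-swap s≅)

  hat-on-pop : ∀ t st x xs → ¬ Occurrence (t ∷ st) σ → Occurrence (x ∷ t ∷ st) σ →
               Occurrence (t ∷ proj₂ (pushτ σ st x) ++ runτ σ (proj₁ (pushτ σ st x)) xs) (hat σ)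
  hat-on-pop t []        x xs avoid has = hat-after-pop t [] x xs avoid (singleton-avoids x) has
  hat-on-pop t (t′ ∷ st) x xs avoid has with contains? (x ∷ t′ ∷ st) σ
  ... | no avoid′ = hat-after-pop t (t′ ∷ st) x xs avoid (avoid′ ∘ Occurrence⇒Contains) has
  ... | yes has′  = Occurrence-mono (t ∷ʳ ⊆-refl)
    (hat-on-pop t′ st x xs (avoid ∘ Occurrence-mono (t ∷ʳ ⊆-refl)) (Contains⇒Occurrence _ has′))

  runσ-hat : ∀ xs st → ¬ Occurrence st σ → Occurrence (xs ʳ++ st) σ → Occurrence (runτ σ st xs) (hat σ)
  runσ-hat []       st       avoid has = ⊥-elim (avoid has)
  runσ-hat (x ∷ xs) []       _     has = runσ-hat xs [ x ] (singleton-avoids x) has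
  runσ-hat (x ∷ xs) (t ∷ st) avoid has with contains? (x ∷ t ∷ st) σ
  ... | no avoid′ = runσ-hat xs (x ∷ t ∷ st) (avoid′ ∘ Occurrence⇒Contains) has
  ... | yes has′  = hat-on-pop t st x xs avoid (Contains⇒Occurrence _ has′)

module σ-Sorting (σ₁ σ₂ : ℕ) (σ′ : List ℕ) (hat⊒231 : Occurrence (σ₂ ∷ σ₁ ∷ σ′) p231) where
  open σ-Stack σ₁ σ₂ σ′

  stackσ-reverse : ∀ π → Avoids π (reverse σ) → stackOut σ π ≡ reverse π
  stackσ-reverse π avoid = runσ-no-pop π [] λ occ → avoid (Occurrence⇒Contains (Occurrence-reverseˡ π occ))

  Sortable⇒avoids-reverse : ∀ π → Sortable σ π → Avoids π (reverse σ)
  Sortable⇒avoids-reverse π sortable has = proj₁ (stack21-sorted⇔avoids231 (stackOut σ π)) sortable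
    (Occurrence⇒Contains (Occurrence-trans output⊒hat hat⊒231))
    where
    output⊒hat : Occurrence (stackOut σ π) (hat σ)
    output⊒hat = runσ-hat π [] (λ occ → singleton-avoids 0 (Occurrence-mono (minimum _) occ))
                   (Occurrence-reverseʳ (Contains⇒Occurrence π has))

  Sortable⇔avoids : ∀ π → Sortable σ π ⟺ (Avoids π p132 × Avoids π (reverse σ))
  Sortable⇔avoids π = sortable⇒avoids , avoids⇒sortable
    where
    sortable⇒avoids : Sortable σ π → Avoids π p132 × Avoids π (reverse σ)
    sortable⇒avoids sortable = avoids132 , avoids-rev
      where
      avoids-rev : Avoids π (reverse σ)
      avoids-rev = Sortable⇒avoids-reverse π sortable
      avoids132 : Avoids π p132
      avoids132 has = proj₁ (stack21-sorted⇔avoids231 (reverse π))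
        (subst (Linked _≤_ ∘ stackOut p21) (stackσ-reverse π avoids-rev) sortable)
        (Occurrence⇒Contains (Occurrence-reverse (Contains⇒Occurrence π has)))

    avoids⇒sortable : Avoids π p132 × Avoids π (reverse σ) → Sortable σ π
    avoids⇒sortable (avoids132 , avoids-rev) =
      subst (Linked _≤_ ∘ stackOut p21) (sym (stackσ-reverse π avoids-rev))
        (proj₂ (stack21-sorted⇔avoids231 (reverse π))
          λ has → avoids132 (Occurrence⇒Contains (Occurrence-reverseˡ π (Contains⇒Occurrence _ has))))

module σ-SortClass (σ₁ σ₂ : ℕ) (σ′ : List ℕ) (σ-cayley : Cayley (σ₁ ∷ σ₂ ∷ σ′))
                   (hat⊒231 : Occurrence (σ₂ ∷ σ₁ ∷ σ′) p231) where
  open σ-Stack σ₁ σ₂ σ′ using (σ)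
  open σ-Sorting σ₁ σ₂ σ′ hat⊒231

  σʳ : List ℕ
  σʳ = reverse σ

  Sort⇔ : ∀ π → Sort σ π ⟺ (Cayley π × Avoids π p132 × Avoids π σʳ)
  Sort⇔ π = (λ (cayley , sortable) → cayley , proj₁ (Sortable⇔avoids π) sortable)
          , (λ (cayley , avoids) → cayley , proj₂ (Sortable⇔avoids π) avoids)

  Sort⇔avoids-all : ∀ π → Sort σ π ⟺ (Cayley π × All (Avoids π) (p132 ∷ σʳ ∷ []))
  Sort⇔avoids-all π =
    (λ s → let cayley , avoids132 , avoidsσʳ = proj₁ (Sort⇔ π) s in cayley , avoids132 ∷ avoidsσʳ ∷ []) ,
    (λ { (cayley , avoids132 ∷ avoidsσʳ ∷ []) → proj₂ (Sort⇔ π) (cayley , avoids132 , avoidsσʳ) })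

  open AvoidanceClass (Sort σ) (p132 ∷ σʳ ∷ []) Sort⇔avoids-all public

  σʳ-long : length p132 ≤ length σʳ
  σʳ-long = subst (3 ≤_) (sym (List.length-reverse σ)) (Occurrence-length hat⊒231)

  basis-avoiding : Avoids σʳ p132 → IsBasis (Sort σ) (p132 ∷ σʳ ∷ [])
  basis-avoiding σʳ-avoids = isBasis (Cayley132 ∷ Cayley-reverse σ σ-cayley ∷ []) antichain
    where
    antichain : ∀ {β β′} → β ∈ p132 ∷ σʳ ∷ [] → β′ ∈ p132 ∷ σʳ ∷ [] →
                Contains β β′ → β′ ≡ β
    antichain (here refl)         (here refl)         _   = refl
    antichain (here refl)         (there (here refl)) has =
      sym (Cayley-Occurrence-long⇒≡ Cayley132 (Cayley-reverse σ σ-cayley) (Contains⇒Occurrence p132 has) σʳ-long)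
    antichain (there (here refl)) (here refl)         has = ⊥-elim (σʳ-avoids has)
    antichain (there (here refl)) (there (here refl)) _   = refl

  basis-containing : Contains σʳ p132 → IsBasis (Sort σ) (p132 ∷ [])
  basis-containing σʳ⊒132 = AvoidanceClass.isBasis (Sort σ) (p132 ∷ []) Sort⇔avoids-132 (Cayley132 ∷ [])
    λ { (here refl) (here refl) _ → refl }
    where
    Sort⇔avoids-132 : ∀ π → Sort σ π ⟺ (Cayley π × All (Avoids π) (p132 ∷ []))
    Sort⇔avoids-132 π = (λ s → let cayley , avoids132 , _ = proj₁ (Sort⇔ π) s in cayley , avoids132 ∷ [])
      , λ { (cayley , avoids132 ∷ []) →
              proj₂ (Sort⇔ π) (cayley , avoids132 , λ has → avoids132 (Contains-trans π has σʳ⊒132)) }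

theorem2 : (σ : List ℕ) → Cayley σ → 2 ≤ length σ →
    Contains (hat σ) (2 ∷ 3 ∷ 1 ∷ []) →
    (∀ π → Sort σ π ⟺ (Cayley π × Avoids π (1 ∷ 3 ∷ 2 ∷ []) × Avoids π (reverse σ)))
    × IsClass (Sort σ)
    × (Avoids (reverse σ) (1 ∷ 3 ∷ 2 ∷ []) → IsBasis (Sort σ) ((1 ∷ 3 ∷ 2 ∷ []) ∷ reverse σ ∷ []))
    × (Contains (reverse σ) (1 ∷ 3 ∷ 2 ∷ []) → IsBasis (Sort σ) ((1 ∷ 3 ∷ 2 ∷ []) ∷ []))
theorem2 []                _         ()       _
theorem2 (_ ∷ [])          _         (s≤s ()) _
theorem2 (σ₁ ∷ σ₂ ∷ σ′) σ-cayley _ hat⊒231 = Sort⇔ , isClass , basis-avoiding , basis-containing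
  where open σ-SortClass σ₁ σ₂ σ′ σ-cayley (Contains⇒Occurrence _ hat⊒231)
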